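{- Let $G$ be a signed multidigraph with $n\geq 2$ vertices and let $v$ be a vertex of $G$. Order the vertices so that $v$ comes first, and write $L(G,X)=J(x_v,{\bf a};L(G-v,X),{\bf b})$, i.e. the first row of $L(G,X)$ is $(x_v,{\bf b})$ and the first column is $(x_v,{\bf a})^T$, with ${\bf a},{\bf b}\in\mathcal{P}^{n-1}$. Then for all $1\leq j\leq n-1$ the critical ideal $I_j(G,X)$ is generated by the union of the following four sets: ${\rm minors}_{j}(L(G-v,X))$, ${\rm minors}_{j}({\bf a}, L(G-v,X))$, ${\rm minors}_{j}(L(G-v,X),{\bf b})$, and \[ \left\{x_v\cdot {\rm det}(M)+{\rm det}( J(0,{\bf a'};M,{\bf b'})) \right\}, \] where the last set runs over all $j\times j$ submatrices of $L(G,X)$ containing the diagonal entry $x_v$, each such submatrix being written as $J(x_v,{\bf a'};M,{\bf b'})$ with $M$ a $(j-1)\times(j-1)$ submatrix of $L(G-v,X)$ and ${\bf a'},{\bf b'}$ the corresponding subvectors of ${\bf a},{\bf b}$. Moreover $I_n(G,X)=\left\langle x_v\cdot {\rm det}(L(G-v,X))+{\rm det}(J(0,{\bf a};L(G-v,X),{\bf b}))\right\rangle$.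
   Context: $\mathcal{P}$ is a principal ideal domain. A signed multidigraph $G$ is a finite multidigraph together with signs $\pm1$ on its arcs; for distinct vertices $u,v$ let $m_{uv}$ be the number of arcs from $u$ to $v$ and $\sigma(uv)\in\{1,-1\}$ their sign. With variables $X_G=\{x_u: u\in V(G)\}$, the generalized Laplacian $L(G,X)$ is the $V(G)\times V(G)$ matrix over $\mathcal{P}[X_G]$ with $L(G,X)_{uu}=x_u$ and $L(G,X)_{uv}=-\sigma(uv)m_{uv}1_{\mathcal P}$ for $u\neq v$. The $i$-th critical ideal $I_i(G,X)\subseteq\mathcal P[X_G]$ is the ideal generated by all $i\times i$ minors of $L(G,X)$. For a square or rectangular matrix $L$, ${\rm minors}_j(L)$ is the set of its $j\times j$ minors. The join of matrices is $J(P,{\bf a};Q,{\bf b})=\left[\begin{smallmatrix} P & {\bf 1}^T{\bf b}\\ {\bf a}^T{\bf 1} & Q\end{smallmatrix}\right]$ (upper right block with all rows ${\bf b}$, lower left block with all columns ${\bf a}^T$). ${\rm minors}_j({\bf a},L(G-v,X))$ denotes the set of determinants of $j\times j$ submatrices of the matrix $[\,{\bf a}^T\ |\ L(G-v,X)\,]$ that contain (part of) its first column ${\bf a}^T$; ${\rm minors}_j(L(G-v,X),{\bf b})$ denotes the set of determinants of $j\times j$ submatrices of $\left[\begin{smallmatrix}{\bf b}\\ L(G-v,X)\end{smallmatrix}\right]$ that contain (part of) its first row ${\bf b}$. -}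

module Defs where

open import Level using (Level; _⊔_) renaming (suc to lsuc)
open import Algebra.Bundles using (CommutativeRing)
open import Data.Nat as ℕ using (ℕ; zero; suc)
open import Data.Fin as Fin using (Fin; zero; suc; punchIn; toℕ)
open import Data.Fin.Properties using (_≟_)
open import Data.Sign using (Sign)
open import Data.Product using (Σ; ∃; _×_; _,_)
open import Data.Sum using (_⊎_)
open import Data.Empty using (⊥)
open import Function using (_∘_; _⇔_)
open import Relation.Nullary using (¬_; yes; no)
open import Relation.Binary.PropositionalEquality using (_≡_)

module _ {c ℓ : Level} (R : CommutativeRing c ℓ) where
  open CommutativeRing R using (Carrier; _≈_; _+_; _*_; -_; 0#; 1#)

  record Ideal : Set (lsuc (c ⊔ ℓ)) where
    field
      mem     : Carrier → Set (c ⊔ ℓ)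
      resp    : ∀ {x y} → x ≈ y → mem x → mem y
      has0    : mem 0#
      closed+ : ∀ {x y} → mem x → mem y → mem (x + y)
      closed* : ∀ r {x} → mem x → mem (r * x)

  IsPrincipal : Ideal → Set (c ⊔ ℓ)
  IsPrincipal I = ∃ λ g → ∀ x → Ideal.mem I x ⇔ (∃ λ r → x ≈ r * g)

  record IsPID : Set (lsuc (c ⊔ ℓ)) where
    field
      nontrivial    : ¬ (1# ≈ 0#)
      noZeroDivisor : ∀ x y → x * y ≈ 0# → (x ≈ 0#) ⊎ (y ≈ 0#)
      principal     : (I : Ideal) → IsPrincipal I

  data Gen {ℓs : Level} (S : Carrier → Set ℓs) : Carrier → Set (c ⊔ ℓ ⊔ ℓs) where
    gen  : ∀ {x} → S x → Gen S x
    gen0 : Gen S 0#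
    gen+ : ∀ {x y} → Gen S x → Gen S y → Gen S (x + y)
    gen* : ∀ r {x} → Gen S x → Gen S (r * x)
    gen≈ : ∀ {x y} → x ≈ y → Gen S x → Gen S y

  _∪_ : ∀ {ℓa ℓb} → (Carrier → Set ℓa) → (Carrier → Set ℓb) → Carrier → Set (ℓa ⊔ ℓb)
  (S ∪ T) x = S x ⊎ T x

  sumFin : ∀ {k} → (Fin k → Carrier) → Carrier
  sumFin {zero}  f = 0#
  sumFin {suc k} f = f zero + sumFin (f ∘ suc)

  altSign : ℕ → Carrier → Carrier
  altSign zero    x = x
  altSign (suc i) x = - altSign i x

  Mat : ℕ → ℕ → Set c
  Mat m n = Fin m → Fin n → Carrier

  det : ∀ {k} → Mat k k → Carrier
  det {zero}  A = 1#
  det {suc k} A = sumFin λ j →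
    altSign (toℕ j) (A zero j * det (λ r s → A (suc r) (punchIn j s)))

  -- Strictly increasing index selections (row / column subsets).
  Increasing : ∀ {j m} → (Fin j → Fin m) → Set
  Increasing f = ∀ i i′ → i Fin.< i′ → f i Fin.< f i′

  sub : ∀ {m n j} → Mat m n → (Fin j → Fin m) → (Fin j → Fin n) → Mat j j
  sub A r s p q = A (r p) (s q)

  minors : ∀ {m n} (j : ℕ) → Mat m n → Carrier → Set ℓ
  minors {m} {n} j A x =
    Σ (Fin j → Fin m) λ r → Σ (Fin j → Fin n) λ s →
      Increasing r × Increasing s × (x ≈ det (sub A r s))

  join : ∀ {k} → Carrier → (Fin k → Carrier) → Mat k k → (Fin k → Carrier) → Mat (suc k) (suc k)
  join p a Q b zero    zero    = p
  join p a Q b zero    (suc s) = b s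
  join p a Q b (suc r) zero    = a r
  join p a Q b (suc r) (suc s) = Q r s

  colAug : ∀ {m} → (Fin m → Carrier) → Mat m m → Mat m (suc m)
  colAug a L r zero    = a r
  colAug a L r (suc s) = L r s

  rowAug : ∀ {m} → (Fin m → Carrier) → Mat m m → Mat (suc m) m
  rowAug b L zero    s = b s
  rowAug b L (suc r) s = L r s

  minorsCol : ∀ {m} (j : ℕ) → (Fin m → Carrier) → Mat m m → Carrier → Set ℓ
  minorsCol {m} j a L x =
    Σ (Fin j → Fin m) λ r → Σ (Fin j → Fin (suc m)) λ s →
      Increasing r × Increasing s × (∃ λ i → s i ≡ zero) × (x ≈ det (sub (colAug a L) r s))

  minorsRow : ∀ {m} (j : ℕ) → Mat m m → (Fin m → Carrier) → Carrier → Set ℓ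
  minorsRow {m} j L b x =
    Σ (Fin j → Fin (suc m)) λ r → Σ (Fin j → Fin m) λ s →
      Increasing r × Increasing s × (∃ λ i → r i ≡ zero) × (x ≈ det (sub (rowAug b L) r s))

  -- { xv·det(M) + det(J(0,a′;M,b′)) } over j×j submatrices J(xv,a′;M,b′) of
  -- J(xv,a;L,b) containing the entry xv  (j = suc k, M a k×k submatrix of L).
  joinSet : ∀ {m} (k : ℕ) → Carrier → (Fin m → Carrier) → Mat m m → (Fin m → Carrier)
          → Carrier → Set ℓ
  joinSet {m} k xv a L b x =
    Σ (Fin k → Fin m) λ r → Σ (Fin k → Fin m) λ s →
      Increasing r × Increasing s ×
      (x ≈ xv * det (sub L r s) + det (join 0# (a ∘ r) (sub L r s) (b ∘ s)))

-- The polynomial ring P[x_0, …, x_{N-1}], constructed as the free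
-- commutative P-algebra on the variables (terms modulo the congruence
-- generated by the commutative ring axioms and the homomorphism laws of
-- the constant embedding P → P[X]).

module Polynomials {c ℓ : Level} (P : CommutativeRing c ℓ) (N : ℕ) where
  private module P = CommutativeRing P

  infixl 6 _⊕_
  infixl 7 _⊛_
  infix  4 _≈ₚ_

  data Poly : Set c where
    con  : P.Carrier → Poly
    var  : Fin N → Poly
    _⊕_  : Poly → Poly → Poly
    _⊛_  : Poly → Poly → Poly
    ⊖_   : Poly → Poly

  data _≈ₚ_ : Poly → Poly → Set (c ⊔ ℓ) where
    ≈refl  : ∀ {p} → p ≈ₚ p
    ≈sym   : ∀ {p q} → p ≈ₚ q → q ≈ₚ p
    ≈trans : ∀ {p q r} → p ≈ₚ q → q ≈ₚ r → p ≈ₚ r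
    ⊕-cong : ∀ {p p′ q q′} → p ≈ₚ p′ → q ≈ₚ q′ → p ⊕ q ≈ₚ p′ ⊕ q′
    ⊛-cong : ∀ {p p′ q q′} → p ≈ₚ p′ → q ≈ₚ q′ → p ⊛ q ≈ₚ p′ ⊛ q′
    ⊖-cong : ∀ {p q} → p ≈ₚ q → ⊖ p ≈ₚ ⊖ q
    ⊕-assoc : ∀ p q r → (p ⊕ q) ⊕ r ≈ₚ p ⊕ (q ⊕ r)
    ⊕-comm  : ∀ p q → p ⊕ q ≈ₚ q ⊕ p
    ⊕-idˡ   : ∀ p → con P.0# ⊕ p ≈ₚ p
    ⊖-invˡ  : ∀ p → (⊖ p) ⊕ p ≈ₚ con P.0#
    ⊛-assoc : ∀ p q r → (p ⊛ q) ⊛ r ≈ₚ p ⊛ (q ⊛ r)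
    ⊛-comm  : ∀ p q → p ⊛ q ≈ₚ q ⊛ p
    ⊛-idˡ   : ∀ p → con P.1# ⊛ p ≈ₚ p
    distribˡ : ∀ p q r → p ⊛ (q ⊕ r) ≈ₚ (p ⊛ q) ⊕ (p ⊛ r)
    con-cong : ∀ {r s} → r P.≈ s → con r ≈ₚ con s
    con-+   : ∀ r s → con (r P.+ s) ≈ₚ con r ⊕ con s
    con-*   : ∀ r s → con (r P.* s) ≈ₚ con r ⊛ con s
    con--   : ∀ r → con (P.- r) ≈ₚ ⊖ con r

  open import Algebra.Structures using (IsCommutativeRing)
  open import Algebra.Consequences.Setoid using (comm∧distrˡ⇒distrʳ; comm∧idˡ⇒idʳ; comm∧invˡ⇒invʳ)
  open import Relation.Binary.Structures using (IsEquivalence)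

  private
    isEq : IsEquivalence _≈ₚ_
    isEq = record { refl = ≈refl ; sym = ≈sym ; trans = ≈trans }


  polyRing : CommutativeRing c (c ⊔ ℓ)
  polyRing = record
    { Carrier = Poly ; _≈_ = _≈ₚ_ ; _+_ = _⊕_ ; _*_ = _⊛_ ; -_ = ⊖_
    ; 0# = con P.0# ; 1# = con P.1#
    ; isCommutativeRing = record
      { isRing = record
        { +-isAbelianGroup = record
          { isGroup = record
            { isMonoid = record
              { isSemigroup = record
                { isMagma = record { isEquivalence = isEq ; ∙-cong = ⊕-cong }
                ; assoc = ⊕-assoc }
              ; identity = ⊕-idˡ , comm∧idˡ⇒idʳ setoid ⊕-comm ⊕-idˡ }
            ; inverse = ⊖-invˡ , comm∧invˡ⇒invʳ setoid ⊕-comm ⊖-invˡ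
            ; ⁻¹-cong = ⊖-cong }
          ; comm = ⊕-comm }
        ; *-cong = ⊛-cong
        ; *-assoc = ⊛-assoc
        ; *-identity = ⊛-idˡ , comm∧idˡ⇒idʳ setoid ⊛-comm ⊛-idˡ
        ; distrib = distribˡ , comm∧distrˡ⇒distrʳ setoid ⊕-cong ⊛-comm distribˡ }
      ; *-comm = ⊛-comm } }
    where
    open import Relation.Binary.Bundles using (Setoid)
    setoid : Setoid c (c ⊔ ℓ)
    setoid = record { isEquivalence = isEq }

record SignedMultidigraph (n : ℕ) : Set where
  field
    mult : Fin n → Fin n → ℕ      -- m_{uv}: number of arcs u → v (u ≠ v)
    sign : Fin n → Fin n → Sign

deleteFirst : ∀ {n} → SignedMultidigraph (suc n) → SignedMultidigraph n
deleteFirst G = record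
  { mult = λ u w → SignedMultidigraph.mult G (suc u) (suc w)
  ; sign = λ u w → SignedMultidigraph.sign G (suc u) (suc w) }

module _ {c ℓ : Level} (P : CommutativeRing c ℓ) where
  open CommutativeRing P using (Carrier; _+_; _*_; -_; 0#; 1#)

  natP : ℕ → Carrier
  natP zero    = 0#
  natP (suc k) = 1# + natP k

  signP : Sign → Carrier
  signP Sign.+ = 1#
  signP Sign.- = - 1#

  genLaplacian : ∀ {n N} → SignedMultidigraph n → (Fin n → Polynomials.Poly P N)
               → Fin n → Fin n → Polynomials.Poly P N
  genLaplacian G x u w with u ≟ w
  ... | yes _ = x u
  ... | no  _ = Polynomials.con (- (signP (SignedMultidigraph.sign G u w)
                                    * natP (SignedMultidigraph.mult G u w)))

  polyVar : (N : ℕ) → Fin N → Polynomials.Poly P N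
  polyVar N i = Polynomials.var i

-- The proposition is really a statement
-- about minors of an arbitrary join matrix J(p, a; Q, b) over an arbitrary
-- commutative ring, and it is proved at that generality:
--
--  * Laplace expansion along the first row shows that the determinant of a
--    join is affine in its corner entry:
--        det J(p, a; Q, b) = p · det Q + det J(0, a; Q, b).
--  * A strictly increasing selection of rows (or columns) of J either avoids
--    index 0, and then selects rows of Q (resp. of [aᵀ | Q]), or starts at
--    index 0, and then is 0 followed by a selection of rows of Q.
--  * Splitting both the row and the column selection of a (k+1)-minor of
--    J this way gives its four kinds: a minor of Q, of [aᵀ | Q], of [b ; Q],
--    or (both selections start at 0) a minor of a smaller join, which by the
--    corner formula is an element of the fourth generating set.  Conversely
--    every element of the four sets is a minor of J.  Since the two
--    generating sets are contained in each other's generated ideals, these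
--    ideals coincide.
--  * A strictly increasing self-map of Fin n is the identity, so the only
--    full-size minor of J is det J itself, which gives the case j = n.
--
-- Finally the Laplacian agrees entrywise with J(x_v, a; L(G-v,X), b), and
-- pointwise equal matrices have the same minors.

module Submission where

open import Defs
open import Level using (Level)
open import Algebra.Bundles using (CommutativeRing)
open import Data.Nat using (ℕ; suc; _≤_)
open import Data.Fin using (Fin; zero; suc)
open import Data.Product using (_×_)
open import Function using (_∘_; _⇔_)

import Data.Nat as ℕ
import Data.Nat.Properties as ℕ
import Data.Fin as Fin
open import Data.Fin.Properties using (_≟_; pigeonhole)
open import Data.Product using (Σ; _,_; proj₁; proj₂)
open import Data.Sum using (_⊎_; inj₁; inj₂)
open import Data.Empty using (⊥-elim)
open import Function.Bundles using (mk⇔)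
open import Relation.Nullary using (yes; no)
open import Relation.Binary.PropositionalEquality as Eq using (_≡_; _≢_; cong; cong₂)

-- Strictly increasing index selections.  Defs parameterises Increasing by a
-- ring it does not depend on, hence the module parameter.

module Selections {c ℓ : Level} (R : CommutativeRing c ℓ) where

  Incr : ∀ {j n} → (Fin j → Fin n) → Set
  Incr = Increasing R

  cons : ∀ {j n} → (Fin j → Fin n) → Fin (suc j) → Fin (suc n)
  cons r zero    = zero
  cons r (suc i) = suc (r i)

  incr-suc : ∀ {j n} {r : Fin j → Fin n} → Incr r → Incr (suc ∘ r)
  incr-suc inc i i′ i<i′ = ℕ.s≤s (inc i i′ i<i′)

  incr-cons : ∀ {j n} {r : Fin j → Fin n} → Incr r → Incr (cons r)
  incr-cons inc zero    (suc i′) _             = ℕ.s≤s ℕ.z≤n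
  incr-cons inc (suc i) (suc i′) (ℕ.s≤s i<i′) = ℕ.s≤s (inc i i′ i<i′)

  tail-nonzero : ∀ {j n} {r : Fin (suc j) → Fin (suc n)} → Incr r → ∀ i → r (suc i) ≢ zero
  tail-nonzero {r = r} inc i r[1+i]≡0
    with Eq.subst (λ t → Fin.toℕ (r zero) ℕ.< Fin.toℕ t) r[1+i]≡0 (inc zero (suc i) (ℕ.s≤s ℕ.z≤n))
  ... | ()

  lower : ∀ {j n} (r : Fin j → Fin (suc n)) → (∀ i → r i ≢ zero) → Incr r →
          Σ (Fin j → Fin n) λ r′ → Incr r′ × (∀ i → r i ≡ suc (r′ i))
  lower {n = n} r nonzero inc = r′ , incr′ , r≡suc
    where
    pred : (t : Fin (suc n)) → t ≢ zero → Σ (Fin n) λ t′ → t ≡ suc t′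
    pred zero    t≢0 = ⊥-elim (t≢0 Eq.refl)
    pred (suc t) _   = t , Eq.refl
    r′ : Fin _ → Fin n
    r′ i = proj₁ (pred (r i) (nonzero i))
    r≡suc : ∀ i → r i ≡ suc (r′ i)
    r≡suc i = proj₂ (pred (r i) (nonzero i))
    incr′ : Incr r′
    incr′ i i′ i<i′ =
      ℕ.≤-pred (Eq.subst₂ Fin._<_ (r≡suc i) (r≡suc i′) (inc i i′ i<i′))

  split : ∀ {j n} (r : Fin (suc j) → Fin (suc n)) → Incr r →
          (Σ (Fin (suc j) → Fin n) λ r′ → Incr r′ × (∀ i → r i ≡ suc (r′ i)))
          ⊎ (Σ (Fin j → Fin n) λ r′ → Incr r′ × (∀ i → r i ≡ cons r′ i))
  split r inc with r zero ≟ zero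
  ... | no r0≢0 = inj₁ (lower r nonzero inc)
    where
    nonzero : ∀ i → r i ≢ zero
    nonzero zero    = r0≢0
    nonzero (suc i) = tail-nonzero inc i
  ... | yes r0≡0 with lower (r ∘ suc) (tail-nonzero inc)
                         (λ i i′ i<i′ → inc (suc i) (suc i′) (ℕ.s≤s i<i′))
  ...   | r′ , incr′ , r∘suc≡suc = inj₂ (r′ , incr′ , r≡cons)
    where
    r≡cons : ∀ i → r i ≡ cons r′ i
    r≡cons zero    = r0≡0
    r≡cons (suc i) = r∘suc≡suc i

  -- The only strictly increasing self-map of Fin n is the identity
  -- (a selection avoiding 0 would inject Fin (1 + n) into Fin n).
  incr-self-map-id : ∀ {n} (r : Fin n → Fin n) → Incr r → ∀ i → r i ≡ i
  incr-self-map-id {suc n} r inc i with split r inc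
  ... | inj₁ (r′ , incr′ , _) with pigeonhole (ℕ.n<1+n n) r′
  ...   | i₁ , i₂ , i₁<i₂ , r′i₁≡r′i₂ =
          ⊥-elim (ℕ.<-irrefl (cong Fin.toℕ r′i₁≡r′i₂) (incr′ i₁ i₂ i₁<i₂))
  incr-self-map-id {suc n} r inc zero    | inj₂ (_ , _ , r≡cons) = r≡cons zero
  incr-self-map-id {suc n} r inc (suc i) | inj₂ (r′ , incr′ , r≡cons) =
    Eq.trans (r≡cons (suc i)) (cong suc (incr-self-map-id r′ incr′ i))

module Determinants {c ℓ : Level} (R : CommutativeRing c ℓ) where
  open CommutativeRing R
    using (Carrier; _≈_; _+_; _*_; 0#; refl; sym; trans; reflexive;
           +-cong; *-cong; -‿cong; +-congʳ; zeroˡ; +-identityˡ)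
  open Selections R

  sumFin-cong : ∀ {k} {f g : Fin k → Carrier} → (∀ i → f i ≈ g i) → sumFin R f ≈ sumFin R g
  sumFin-cong {ℕ.zero} _   = refl
  sumFin-cong {suc k}  f≈g = +-cong (f≈g zero) (sumFin-cong (f≈g ∘ suc))

  altSign-cong : ∀ n {x y} → x ≈ y → altSign R n x ≈ altSign R n y
  altSign-cong ℕ.zero  x≈y = x≈y
  altSign-cong (suc n) x≈y = -‿cong (altSign-cong n x≈y)

  det-cong : ∀ {k} {A B : Mat R k k} → (∀ i j → A i j ≈ B i j) → det R A ≈ det R B
  det-cong {ℕ.zero} _   = refl
  det-cong {suc k}  A≈B = sumFin-cong λ j → altSign-cong (Fin.toℕ j)
    (*-cong (A≈B zero j) (det-cong λ r s → A≈B (suc r) (Fin.punchIn j s)))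

  minors-transport : ∀ {m n j} {A B : Mat R m n} → (∀ r s → A r s ≈ B r s) →
                     ∀ {y} → minors R j A y → minors R j B y
  minors-transport A≈B (r , s , incr , incs , y≈det) =
    r , s , incr , incs , trans y≈det (det-cong λ i j → A≈B (r i) (s j))

  -- The determinant of a join is affine in the corner entry: only the first
  -- term of the expansion along the first row involves p, and the minors
  -- complementary to the other first-row entries do not see p at all.
  det-join-corner : ∀ {k} p a (Q : Mat R k k) b →
    det R (join R p a Q b) ≈ p * det R Q + det R (join R 0# a Q b)
  det-join-corner p a Q b = +-cong refl (trans
      (sumFin-cong λ j → altSign-cong (suc (Fin.toℕ j))
        (*-cong refl (det-cong λ r s → below-first-row r (Fin.punchIn (suc j) s))))
      (sym (trans (+-congʳ (zeroˡ _)) (+-identityˡ _))))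
    where
    below-first-row : ∀ r t → join R p a Q b (suc r) t ≈ join R 0# a Q b (suc r) t
    below-first-row r zero    = refl
    below-first-row r (suc t) = refl

  gen-map : ∀ {ℓs ℓt} {S : Carrier → Set ℓs} {T : Carrier → Set ℓt} →
            (∀ {y} → S y → Gen R T y) → ∀ {y} → Gen R S y → Gen R T y
  gen-map S⊆⟨T⟩ (gen s)         = S⊆⟨T⟩ s
  gen-map S⊆⟨T⟩ gen0            = gen0
  gen-map S⊆⟨T⟩ (gen+ y₁ y₂)    = gen+ (gen-map S⊆⟨T⟩ y₁) (gen-map S⊆⟨T⟩ y₂)
  gen-map S⊆⟨T⟩ (gen* r y)      = gen* r (gen-map S⊆⟨T⟩ y)
  gen-map S⊆⟨T⟩ (gen≈ x≈y y)    = gen≈ x≈y (gen-map S⊆⟨T⟩ y)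

  det-sub-reindex : ∀ {m n j} (A : Mat R m n) {r r′ : Fin j → Fin m} {s s′ : Fin j → Fin n} →
                    (∀ i → r i ≡ r′ i) → (∀ i → s i ≡ s′ i) →
                    det R (sub R A r s) ≈ det R (sub R A r′ s′)
  det-sub-reindex A r≡r′ s≡s′ = det-cong λ i j → reflexive (cong₂ A (r≡r′ i) (s≡s′ j))

module JoinMinors {c ℓ : Level} (R : CommutativeRing c ℓ) {n : ℕ}
                  (p : CommutativeRing.Carrier R) (a : Fin n → CommutativeRing.Carrier R)
                  (Q : Mat R n n) (b : Fin n → CommutativeRing.Carrier R) where
  open CommutativeRing R using (Carrier; _≈_; _+_; _*_; 0#; sym; trans; reflexive)
  open Selections R
  open Determinants R using (det-cong; det-join-corner; det-sub-reindex)

  J : Mat R (suc n) (suc n)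
  J = join R p a Q b

  colAug-rows : ∀ u t → colAug R a Q u t ≡ J (suc u) t
  colAug-rows u zero    = Eq.refl
  colAug-rows u (suc t) = Eq.refl

  rowAug-cols : ∀ t u → rowAug R b Q t u ≡ J t (suc u)
  rowAug-cols zero    u = Eq.refl
  rowAug-cols (suc t) u = Eq.refl

  sub-through-corner : ∀ {k} (r s : Fin k → Fin n) i j →
    sub R J (cons r) (cons s) i j ≡ join R p (a ∘ r) (sub R Q r s) (b ∘ s) i j
  sub-through-corner r s zero    zero    = Eq.refl
  sub-through-corner r s zero    (suc j) = Eq.refl
  sub-through-corner r s (suc i) zero    = Eq.refl
  sub-through-corner r s (suc i) (suc j) = Eq.refl

  det-through-corner : ∀ {k} (r s : Fin k → Fin n) →
    det R (sub R J (cons r) (cons s))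
    ≈ p * det R (sub R Q r s) + det R (join R 0# (a ∘ r) (sub R Q r s) (b ∘ s))
  det-through-corner r s =
    trans (det-cong λ i j → reflexive (sub-through-corner r s i j))
          (det-join-corner p (a ∘ r) (sub R Q r s) (b ∘ s))

  Generators : ℕ → Carrier → Set ℓ
  Generators k = _∪_ R (_∪_ R (minors R (suc k) Q) (minorsCol R (suc k) a Q))
                       (_∪_ R (minorsRow R (suc k) Q b) (joinSet R k p a Q b))

  -- Every (1 + k)-minor of J is one of the generators, according to whether
  -- its row and column selections avoid or start at index 0.
  minor⇒generator : ∀ k {y} → minors R (suc k) J y → Generators k y
  minor⇒generator k {y} (r , s , incr , incs , y≈det) with split r incr | split s incs
  ... | inj₁ (r′ , incr′ , r≡) | inj₁ (s′ , incs′ , s≡) =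
    inj₁ (inj₁ (r′ , s′ , incr′ , incs′ , trans y≈det (det-sub-reindex J r≡ s≡)))
  ... | inj₁ (r′ , incr′ , r≡) | inj₂ (_ , _ , s≡) =
    inj₁ (inj₂ (r′ , s , incr′ , incs , (zero , s≡ zero) ,
      trans y≈det (trans (det-sub-reindex J {s′ = s} r≡ (λ _ → Eq.refl))
                         (det-cong λ i j → reflexive (Eq.sym (colAug-rows (r′ i) (s j)))))))
  ... | inj₂ (_ , _ , r≡) | inj₁ (s′ , incs′ , s≡) =
    inj₂ (inj₁ (r , s′ , incr , incs′ , (zero , r≡ zero) ,
      trans y≈det (trans (det-sub-reindex J {r′ = r} (λ _ → Eq.refl) s≡)
                         (det-cong λ i j → reflexive (Eq.sym (rowAug-cols (r i) (s′ j)))))))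
  ... | inj₂ (r′ , incr′ , r≡) | inj₂ (s′ , incs′ , s≡) =
    inj₂ (inj₂ (r′ , s′ , incr′ , incs′ ,
      trans y≈det (trans (det-sub-reindex J r≡ s≡) (det-through-corner r′ s′))))

  generator⇒minor : ∀ k {y} → Generators k y → minors R (suc k) J y
  generator⇒minor k (inj₁ (inj₁ (r , s , incr , incs , y≈det))) =
    suc ∘ r , suc ∘ s , incr-suc incr , incr-suc incs , y≈det
  generator⇒minor k (inj₁ (inj₂ (r , s , incr , incs , _ , y≈det))) =
    suc ∘ r , s , incr-suc incr , incs ,
    trans y≈det (det-cong λ i j → reflexive (colAug-rows (r i) (s j)))
  generator⇒minor k (inj₂ (inj₁ (r , s , incr , incs , _ , y≈det))) =
    r , suc ∘ s , incr , incr-suc incs ,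
    trans y≈det (det-cong λ i j → reflexive (rowAug-cols (r i) (s j)))
  generator⇒minor k (inj₂ (inj₂ (r , s , incr , incs , y≈expr))) =
    cons r , cons s , incr-cons incr , incr-cons incs ,
    trans y≈expr (sym (det-through-corner r s))

  TopGenerator : Carrier → Set ℓ
  TopGenerator y = y ≈ p * det R Q + det R (join R 0# a Q b)

  fullMinor⇒top : ∀ {y} → minors R (suc n) J y → TopGenerator y
  fullMinor⇒top (r , s , incr , incs , y≈det) =
    trans y≈det (trans (det-sub-reindex J (incr-self-map-id r incr) (incr-self-map-id s incs))
                       (det-join-corner p a Q b))

  top⇒fullMinor : ∀ {y} → TopGenerator y → minors R (suc n) J y
  top⇒fullMinor y≈expr =
    (λ i → i) , (λ i → i) , (λ _ _ lt → lt) , (λ _ _ lt → lt) ,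
    trans y≈expr (sym (det-join-corner p a Q b))

module LaplacianSplit {c ℓ : Level} (P : CommutativeRing c ℓ) {m : ℕ}
                      (G : SignedMultidigraph (suc m)) where
  x = polyVar P (suc m)
  L = genLaplacian P G x
  L′ = genLaplacian P (deleteFirst G) (x ∘ suc)

  laplacian-deleteFirst : ∀ u w → L (suc u) (suc w) ≡ L′ u w
  laplacian-deleteFirst u w with u ≟ w
  ... | yes _ = Eq.refl
  ... | no  _ = Eq.refl

  laplacian-join : ∀ i j →
    L i j ≡ join (Polynomials.polyRing P (suc m)) (x zero)
                 (λ u → L (suc u) zero) L′ (λ w → L zero (suc w)) i j
  laplacian-join zero    zero    = Eq.refl
  laplacian-join zero    (suc j) = Eq.refl
  laplacian-join (suc i) zero    = Eq.refl
  laplacian-join (suc i) (suc j) = laplacian-deleteFirst i j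

proposition2p3 : ∀ {c ℓ : Level} (P : CommutativeRing c ℓ) → IsPID P →
    (m : ℕ) → 1 ≤ m → (G : SignedMultidigraph (suc m)) →
    let R   = Polynomials.polyRing P (suc m)
        x   = polyVar P (suc m)
        _+_ = CommutativeRing._+_ R
        _*_ = CommutativeRing._*_ R
        _≈_ = CommutativeRing._≈_ R
        0R  = CommutativeRing.0# R
        L   = genLaplacian P G x
        L′  = genLaplacian P (deleteFirst G) (x ∘ suc)
        xv  = x zero
        a   = λ (i : Fin m) → L (suc i) zero
        b   = λ (i : Fin m) → L zero (suc i)
    in (∀ (k : ℕ) → suc k ≤ m → ∀ p →
          Gen R (minors R (suc k) L) p
          ⇔ Gen R (_∪_ R (_∪_ R (minors R (suc k) L′) (minorsCol R (suc k) a L′))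
                         (_∪_ R (minorsRow R (suc k) L′ b) (joinSet R k xv a L′ b))) p)
       × (∀ p → Gen R (minors R (suc m) L) p
                ⇔ Gen R (λ q → q ≈ ((xv * det R L′) + det R (join R 0R a L′ b))) p)
proposition2p3 P _ m _ G =
  (λ k _ _ → mk⇔ (gen-map (gen ∘ minor⇒generator k ∘ toJoin))
                 (gen-map (gen ∘ fromJoin ∘ generator⇒minor k))) ,
  (λ _ → mk⇔ (gen-map (gen ∘ fullMinor⇒top ∘ toJoin))
             (gen-map (gen ∘ fromJoin ∘ top⇒fullMinor)))
  where
  open LaplacianSplit P G
  R = Polynomials.polyRing P (suc m)
  open CommutativeRing R using (reflexive)
  open Determinants R using (gen-map; minors-transport)
  open JoinMinors R (x zero) (λ u → L (suc u) zero) L′ (λ w → L zero (suc w))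

  toJoin : ∀ {j y} → minors R j L y → minors R j J y
  toJoin = minors-transport λ r s → reflexive (laplacian-join r s)

  fromJoin : ∀ {j y} → minors R j J y → minors R j L y
  fromJoin = minors-transport λ r s → reflexive (Eq.sym (laplacian-join r s))
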